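{- Let $G$ be a connected graph with at least three vertices, let $H$ be a square root of $G$, and let $S\subseteq V(G)$ with $|S|=k$ be such that $H-S$ is isomorphic to $pK_1+qK_2$ for some $p,q$. (a) If $Q$ is an equivalence class of the set of comparable ordered pairs of vertices of $G$ under $\sim_{nt}$ and $|Q|\geq 2k+2^{2k}+1$, then $Q$ contains two pairs $(a_1,b_1)$, $(a_2,b_2)$ such that $a_1b_1$ and $a_2b_2$ are $S$-matching edges of type 1 in $H$ (with $N_H(a_i)\cap S=\emptyset$) satisfying $N_H(b_1)\cap S=N_H(b_2)\cap S\neq\emptyset$. (b) If $Q$ is an equivalence class of the set of ordered pairs of adjacent vertices of $G$ under $\sim_{mt}$ and $|Q|\geq 2k+2^{2k}+1$, then $Q$ contains two pairs $(a_1,b_1)$, $(a_2,b_2)$ such that $a_1b_1$ and $a_2b_2$ are $S$-matching edges of type 2 in $H$ satisfying $N_H(a_1)\cap S=N_H(a_2)\cap S$ and $N_H(b_1)\cap S=N_H(b_2)\cap S$.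
   Context: Graphs are finite, simple, undirected. $H$ is a square root of $G$ if $V(H)=V(G)$ and two distinct vertices are adjacent in $G$ iff their distance in $H$ is at most two. $pK_1+qK_2$ is the disjoint union of $p$ isolated vertices and $q$ disjoint edges. The edges of $H-S$ are called $S$-matching edges. An $S$-matching edge $ab$ is of type 1 if $N_H(a)\cap S=\emptyset$ and $N_H(b)\cap S\neq\emptyset$; of type 2 if $N_H(a)\cap S$, $N_H(b)\cap S$ are both nonempty and disjoint; of type 3 if they are both nonempty and intersect. For a graph $G$: ordered pairs $(x,y)$, $(z,w)$ of adjacent vertices are matched twins, $(x,y)\sim_{mt}(z,w)$, if $N_G[x]\setminus\{y\}=N_G[z]\setminus\{w\}$ and $N_G[y]\setminus\{x\}=N_G[w]\setminus\{z\}$; a pair $(x,y)$ is comparable if $N_G[x]\subseteq N_G[y]$; comparable pairs are nested twins, $(x,y)\sim_{nt}(z,w)$, if $N_G(x)\setminus\{y\}=N_G(z)\setminus\{w\}$ and $N_G[y]\setminus\{x\}=N_G[w]\setminus\{z\}$. Both are equivalence relations on the respective sets of pairs. -}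

module Defs where

open import Data.Nat using (ℕ; _+_; _*_; _^_; _≤_; suc)
open import Data.Fin using (Fin)
open import Data.Fin.Subset using (Subset; _∈_; _∉_; ∣_∣)
open import Data.Bool using (Bool; true; false)
open import Data.Product using (Σ; ∃; ∃-syntax; _×_; _,_)
open import Data.Sum using (_⊎_; inj₁; inj₂)
open import Data.Empty using (⊥)
open import Relation.Nullary using (¬_)
open import Relation.Binary.PropositionalEquality using (_≡_; _≢_)
open import Function.Definitions using (Injective)

record Graph (n : ℕ) : Set where
  field
    adj    : Fin n → Fin n → Bool
    sym    : ∀ x y → adj x y ≡ adj y x
    irrefl : ∀ x → adj x x ≡ false

open Graph public

E : ∀ {n} → Graph n → Fin n → Fin n → Set
E G x y = adj G x y ≡ true

_⇔_ : Set → Set → Set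
A ⇔ B = (A → B) × (B → A)
infix 3 _⇔_

data Reach {n} (G : Graph n) (x : Fin n) : Fin n → Set where
  here : Reach G x x
  step : ∀ {y z} → Reach G x y → E G y z → Reach G x z

Connected : ∀ {n} → Graph n → Set
Connected G = ∀ x y → Reach G x y

IsSquareRoot : ∀ {n} → Graph n → Graph n → Set
IsSquareRoot {n} H G =
  ∀ x y → x ≢ y → (E G x y ⇔ (E H x y ⊎ Σ (Fin n) λ z → E H x z × E H z y))

-- The graph pK₁ + qK₂ on vertex type Fin p ⊎ (Fin q × Bool):
-- inj₁ i are the isolated vertices, (j , false) — (j , true) are the edges.
PQAdj : (p q : ℕ) → (Fin p ⊎ (Fin q × Bool)) → (Fin p ⊎ (Fin q × Bool)) → Set
PQAdj p q (inj₂ (i , b)) (inj₂ (j , c)) = (i ≡ j) × (b ≢ c)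
PQAdj p q _ _ = ⊥

VOut : ∀ {n} → Subset n → Set
VOut {n} S = Σ (Fin n) λ v → v ∉ S

record IsoPQ {n} (H : Graph n) (S : Subset n) (p q : ℕ) : Set where
  field
    to      : VOut S → Fin p ⊎ (Fin q × Bool)
    from    : Fin p ⊎ (Fin q × Bool) → VOut S
    from-to : ∀ u → from (to u) ≡ u
    to-from : ∀ w → to (from w) ≡ w
    pres    : ∀ (u v : VOut S) →
              E H (Data.Product.proj₁ u) (Data.Product.proj₁ v) ⇔ PQAdj p q (to u) (to v)

InN : ∀ {n} → Graph n → Fin n → Fin n → Set
InN G x v = E G x v

InNc : ∀ {n} → Graph n → Fin n → Fin n → Set
InNc G x v = (v ≡ x) ⊎ E G x v

MT : ∀ {n} → Graph n → (Fin n × Fin n) → (Fin n × Fin n) → Set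
MT G (x , y) (z , w) =
  (∀ v → (InNc G x v × v ≢ y) ⇔ (InNc G z v × v ≢ w)) ×
  (∀ v → (InNc G y v × v ≢ x) ⇔ (InNc G w v × v ≢ z))

AdjPair : ∀ {n} → Graph n → (Fin n × Fin n) → Set
AdjPair G (x , y) = E G x y

Comparable : ∀ {n} → Graph n → (Fin n × Fin n) → Set
Comparable G (x , y) = E G x y × (∀ v → InNc G x v → InNc G y v)

NT : ∀ {n} → Graph n → (Fin n × Fin n) → (Fin n × Fin n) → Set
NT G (x , y) (z , w) =
  (∀ v → (InN G x v × v ≢ y) ⇔ (InN G z v × v ≢ w)) ×
  (∀ v → (InNc G y v × v ≢ x) ⇔ (InNc G w v × v ≢ z))

InClass : ∀ {n} → (P : (Fin n × Fin n) → Set) → (R : (Fin n × Fin n) → (Fin n × Fin n) → Set)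
        → (r : Fin n × Fin n) → (Fin n × Fin n) → Set
InClass P R r u = P u × R r u

AtLeast : ∀ {n} → ℕ → ((Fin n × Fin n) → Set) → Set
AtLeast {n} m Q = Σ (Fin m → Fin n × Fin n) λ f → Injective _≡_ _≡_ f × (∀ i → Q (f i))

MeetsS : ∀ {n} → Graph n → Subset n → Fin n → Set
MeetsS {n} H S a = Σ (Fin n) λ s → s ∈ S × E H a s

AvoidsS : ∀ {n} → Graph n → Subset n → Fin n → Set
AvoidsS H S a = ∀ s → s ∈ S → ¬ E H a s

SameS : ∀ {n} → Graph n → Subset n → Fin n → Fin n → Set
SameS H S a b = ∀ s → s ∈ S → (E H a s ⇔ E H b s)

DisjS : ∀ {n} → Graph n → Subset n → Fin n → Fin n → Set
DisjS H S a b = ∀ s → s ∈ S → E H a s → ¬ E H b s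

SMatching : ∀ {n} → Graph n → Subset n → Fin n → Fin n → Set
SMatching H S a b = a ∉ S × b ∉ S × E H a b

Type1 : ∀ {n} → Graph n → Subset n → Fin n → Fin n → Set
Type1 H S a b = SMatching H S a b × AvoidsS H S a × MeetsS H S b

Type2 : ∀ {n} → Graph n → Subset n → Fin n → Fin n → Set
Type2 H S a b = SMatching H S a b × MeetsS H S a × MeetsS H S b × DisjS H S a b

bound : ℕ → ℕ
bound k = 2 * k + 2 ^ (2 * k) + 1

-- Label a pair (x , y) by x if x ∈ S, by y if y ∈ S, and otherwise by its pair of
-- traces (N_H(x) ∩ S , N_H(y) ∩ S).  There are at most 2k + 4^k labels, so a twin
-- class with more members contains two distinct pairs with the same label.  Distinct
-- twin pairs differ in both coordinates, hence both pairs lie in H − S and have the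
-- same traces.  The twin conditions then force non-adjacencies in G, and since
-- H − S is a matching and G = H², these decide which endpoints of the H-edge ab see S.
module Submission where

open import Defs hiding (sym)
import Data.Nat as ℕ
open import Data.Nat using (ℕ; _≤_; _+_; _*_; _^_; _<_; z<s)
open import Data.Nat.Properties using (+-assoc; +-identityʳ; ^-distribˡ-+-*; m<m+n; module ≤-Reasoning)
open import Data.Fin using (Fin; zero; suc; _≟_)
open import Data.Fin.Properties using (pigeonhole; <⇒≢)
open import Data.Fin.Subset using (Subset; ∣_∣; _∈_; _∉_; _⊆_; _∩_; inside; outside)
open import Data.Fin.Subset.Properties using (_∈?_; drop-∷-⊆; x∈p∩q⁺; x∈p∩q⁻)
open import Data.Vec using (tabulate; _∷_; []; here; there)
open import Data.Vec.Properties using (lookup∘tabulate; []=⇒lookup; lookup⇒[]=)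
open import Data.Bool.Properties using (¬-not)
open import Data.List using (List; []; _∷_; [_]; map; _++_; length; cartesianProductWith)
open import Data.List.Properties using (length-map; length-++)
open import Data.List.Relation.Unary.Any using (here; there; index)
open import Data.List.Membership.Propositional using () renaming (_∈_ to _∈ₗ_)
open import Data.List.Membership.Propositional.Properties
  using (∈-map⁺; ∈-++⁺ˡ; ∈-++⁺ʳ; ∈-cartesianProductWith⁺)
open import Data.List.Membership.Setoid.Properties using (index-injective)
open import Data.Product using (Σ; ∃₂; _×_; _,_; proj₁; proj₂; swap; uncurry)
open import Data.Product.Properties using (,-injective)
open import Data.Sum using (_⊎_; inj₁; inj₂)
open import Data.Sum.Properties using (inj₁-injective; inj₂-injective)
open import Function using (_∘_; case_of_)
open import Relation.Nullary using (¬_; yes; no; contradiction)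
open import Relation.Binary.PropositionalEquality
  using (_≡_; _≢_; refl; sym; trans; cong; cong₂; subst; ≢-sym; setoid; module ≡-Reasoning)

⇔-sym : ∀ {A B : Set} → A ⇔ B → B ⇔ A
⇔-sym (f , g) = g , f

⇔-euclidean : ∀ {A B C : Set} → A ⇔ B → A ⇔ C → B ⇔ C
⇔-euclidean (f , g) (h , k) = h ∘ g , f ∘ k

pigeonhole-∈ : ∀ {A : Set} {m} (xs : List A) (f : Fin m → A) → (∀ i → f i ∈ₗ xs) →
               length xs < m → ∃₂ λ i j → i ≢ j × f i ≡ f j
pigeonhole-∈ {A} xs f f∈xs |xs|<m =
  let i , j , i<j , same-index = pigeonhole |xs|<m (index ∘ f∈xs)
  in i , j , <⇒≢ i<j , index-injective (setoid A) (f∈xs i) (f∈xs j) same-index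

length-cartesianProductWith : ∀ {A B C : Set} (f : A → B → C) (xs : List A) (ys : List B) →
  length (cartesianProductWith f xs ys) ≡ length xs * length ys
length-cartesianProductWith f [] ys = refl
length-cartesianProductWith f (x ∷ xs) ys = begin
  length (map (f x) ys ++ cartesianProductWith f xs ys)
    ≡⟨ length-++ (map (f x) ys) ⟩
  length (map (f x) ys) + length (cartesianProductWith f xs ys)
    ≡⟨ cong₂ _+_ (length-map (f x) ys) (length-cartesianProductWith f xs ys) ⟩
  length ys + length xs * length ys ∎
  where open ≡-Reasoning

elements : ∀ {n} → Subset n → List (Fin n)
elements [] = []
elements (inside ∷ S) = zero ∷ map suc (elements S)
elements (outside ∷ S) = map suc (elements S)

∈-elements : ∀ {n} {S : Subset n} {s} → s ∈ S → s ∈ₗ elements S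
∈-elements {S = inside ∷ S} here = here refl
∈-elements {S = inside ∷ S} (there s∈S) = there (∈-map⁺ suc (∈-elements s∈S))
∈-elements {S = outside ∷ S} (there s∈S) = ∈-map⁺ suc (∈-elements s∈S)

length-elements : ∀ {n} (S : Subset n) → length (elements S) ≡ ∣ S ∣
length-elements [] = refl
length-elements (inside ∷ S) = cong ℕ.suc (trans (length-map suc (elements S)) (length-elements S))
length-elements (outside ∷ S) = trans (length-map suc (elements S)) (length-elements S)

subsetsOf : ∀ {n} → Subset n → List (Subset n)
subsetsOf [] = [ [] ]
subsetsOf (inside ∷ S) = map (inside ∷_) (subsetsOf S) ++ map (outside ∷_) (subsetsOf S)
subsetsOf (outside ∷ S) = map (outside ∷_) (subsetsOf S)

∈-subsetsOf : ∀ {n} {S T : Subset n} → T ⊆ S → T ∈ₗ subsetsOf S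
∈-subsetsOf {S = []} {[]} _ = here refl
∈-subsetsOf {S = inside ∷ S} {inside ∷ T} T⊆S = ∈-++⁺ˡ (∈-map⁺ _ (∈-subsetsOf (drop-∷-⊆ T⊆S)))
∈-subsetsOf {S = inside ∷ S} {outside ∷ T} T⊆S =
  ∈-++⁺ʳ (map (inside ∷_) (subsetsOf S)) (∈-map⁺ _ (∈-subsetsOf (drop-∷-⊆ T⊆S)))
∈-subsetsOf {S = outside ∷ S} {inside ∷ T} T⊆S = contradiction (T⊆S here) λ ()
∈-subsetsOf {S = outside ∷ S} {outside ∷ T} T⊆S = ∈-map⁺ _ (∈-subsetsOf (drop-∷-⊆ T⊆S))

length-subsetsOf : ∀ {n} (S : Subset n) → length (subsetsOf S) ≡ 2 ^ ∣ S ∣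
length-subsetsOf [] = refl
length-subsetsOf (inside ∷ S) = begin
  length (map (inside ∷_) (subsetsOf S) ++ map (outside ∷_) (subsetsOf S))
    ≡⟨ length-++ (map (inside ∷_) (subsetsOf S)) ⟩
  length (map (inside ∷_) (subsetsOf S)) + length (map (outside ∷_) (subsetsOf S))
    ≡⟨ cong₂ _+_ (length-map _ (subsetsOf S)) (length-map _ (subsetsOf S)) ⟩
  length (subsetsOf S) + length (subsetsOf S)
    ≡⟨ cong (λ m → m + m) (length-subsetsOf S) ⟩
  2 ^ ∣ S ∣ + 2 ^ ∣ S ∣
    ≡⟨ cong (2 ^ ∣ S ∣ +_) (+-identityʳ (2 ^ ∣ S ∣)) ⟨
  2 ^ ∣ S ∣ + (2 ^ ∣ S ∣ + 0) ∎
  where open ≡-Reasoning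
length-subsetsOf (outside ∷ S) = trans (length-map _ (subsetsOf S)) (length-subsetsOf S)

punctured-⇔-∉ : ∀ {n} {P Q : Fin n → Set} {a b} →
  (∀ v → (P v × v ≢ a) ⇔ (Q v × v ≢ b)) → b ≢ a → ¬ P b
punctured-⇔-∉ P∖a⇔Q∖b b≢a Pb = proj₂ (proj₁ (P∖a⇔Q∖b _) (Pb , b≢a)) refl

punctured-⇔-≡ : ∀ {n} {P Q : Fin n → Set} {a b} →
  (∀ v → (P v × v ≢ a) ⇔ (Q v × v ≢ b)) → Q a → a ≡ b
punctured-⇔-≡ {a = a} {b} P∖a⇔Q∖b Qa with a ≟ b
... | yes a≡b = a≡b
... | no a≢b = contradiction Qa (punctured-⇔-∉ (⇔-sym ∘ P∖a⇔Q∖b) a≢b)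

module _ {n} (G : Graph n) where

  E-irrefl : ∀ {x} → ¬ E G x x
  E-irrefl {x} e = contradiction (trans (sym e) (irrefl G x)) λ ()

  E⇒≢ : ∀ {x y} → E G x y → x ≢ y
  E⇒≢ e refl = E-irrefl e

  E-sym : ∀ {x y} → E G x y → E G y x
  E-sym {x} {y} e = trans (Graph.sym G y x) e

  NT-euclidean : ∀ {r u v} → NT G r u → NT G r v → NT G u v
  NT-euclidean (ru₁ , ru₂) (rv₁ , rv₂) =
    (λ t → ⇔-euclidean (ru₁ t) (rv₁ t)) , (λ t → ⇔-euclidean (ru₂ t) (rv₂ t))

  MT-euclidean : ∀ {r u v} → MT G r u → MT G r v → MT G u v
  MT-euclidean (ru₁ , ru₂) (rv₁ , rv₂) =
    (λ t → ⇔-euclidean (ru₁ t) (rv₁ t)) , (λ t → ⇔-euclidean (ru₂ t) (rv₂ t))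

  module _ {x y z w} (xy : E G x y) (distinct : (x , y) ≢ (z , w)) where

    NT-distinct⇒both-differ : NT G (x , y) (z , w) → x ≢ z × y ≢ w
    NT-distinct⇒both-differ (nt₁ , nt₂) = x≢z , y≢w
      where
      x≢z : x ≢ z
      x≢z refl = distinct (cong (x ,_) (punctured-⇔-≡ nt₁ xy))
      y≢w : y ≢ w
      y≢w refl = distinct (cong (_, y) (punctured-⇔-≡ nt₂ (inj₂ (E-sym xy))))

    MT-distinct⇒both-differ : MT G (x , y) (z , w) → x ≢ z × y ≢ w
    MT-distinct⇒both-differ (mt₁ , mt₂) = x≢z , y≢w
      where
      x≢z : x ≢ z
      x≢z refl = distinct (cong (x ,_) (punctured-⇔-≡ mt₁ (inj₂ xy)))
      y≢w : y ≢ w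
      y≢w refl = distinct (cong (_, y) (punctured-⇔-≡ mt₂ (inj₂ (E-sym xy))))

  module _ {x y z w} (nt : NT G (x , y) (z , w)) where

    NT⇒¬E-firsts : x ≢ z → ¬ E G x z
    NT⇒¬E-firsts x≢z xz = E-irrefl (proj₁ (proj₁ (proj₁ nt z) (xz , z≢y)))
      where
      z≢y : z ≢ y
      z≢y = punctured-⇔-∉ (proj₂ nt) (≢-sym x≢z) ∘ inj₁

    NT⇒¬E-first-second : y ≢ w → ¬ E G x w
    NT⇒¬E-first-second y≢w = punctured-⇔-∉ (proj₁ nt) (≢-sym y≢w)

    NT⇒E-seconds : E G x y → y ≢ w → E G y w
    NT⇒E-seconds xy y≢w with proj₁ (proj₁ (proj₂ nt y) (inj₁ refl , ≢-sym (E⇒≢ xy)))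
    ... | inj₁ y≡w = contradiction y≡w y≢w
    ... | inj₂ wy = E-sym wy

  module _ {x y z w} (mt : MT G (x , y) (z , w)) where

    MT⇒¬N-first-second : y ≢ w → ¬ InNc G x w
    MT⇒¬N-first-second y≢w = punctured-⇔-∉ (proj₁ mt) (≢-sym y≢w)

    MT⇒E-firsts : E G z w → x ≢ z → E G x z
    MT⇒E-firsts zw x≢z with proj₁ (proj₂ (proj₁ mt z) (inj₁ refl , E⇒≢ zw))
    ... | inj₁ z≡x = contradiction (sym z≡x) x≢z
    ... | inj₂ xz = xz

module Traces {n} (H : Graph n) (S : Subset n) where

  neighbours : Fin n → Subset n
  neighbours v = tabulate (adj H v)

  trace : Fin n → Subset n
  trace v = S ∩ neighbours v

  E⇔∈trace : ∀ {v s} → s ∈ S → E H v s ⇔ s ∈ trace v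
  E⇔∈trace {v} {s} s∈S =
    (λ vs → x∈p∩q⁺ (s∈S , lookup⇒[]= s _ (trans (lookup∘tabulate (adj H v) s) vs))) ,
    (λ s∈trace → trans (sym (lookup∘tabulate (adj H v) s))
                       ([]=⇒lookup (proj₂ (x∈p∩q⁻ S _ s∈trace))))

  trace⊆S : ∀ v → trace v ⊆ S
  trace⊆S v = proj₁ ∘ x∈p∩q⁻ S (neighbours v)

  same-trace⇒SameS : ∀ {x z} → trace x ≡ trace z → SameS H S x z
  same-trace⇒SameS {x} {z} same s s∈S =
    (λ xs → proj₂ (E⇔∈trace s∈S) (subst (s ∈_) same (proj₁ (E⇔∈trace s∈S) xs))) ,
    (λ zs → proj₂ (E⇔∈trace s∈S) (subst (s ∈_) (sym same) (proj₁ (E⇔∈trace s∈S) zs)))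

  Label : Set
  Label = Fin n ⊎ Fin n ⊎ (Subset n × Subset n)

  label : Fin n → Fin n → Label
  label x y with x ∈? S | y ∈? S
  ... | yes _ | _ = inj₁ x
  ... | no _ | yes _ = inj₂ (inj₁ y)
  ... | no _ | no _ = inj₂ (inj₂ (trace x , trace y))

  labels : List Label
  labels = map inj₁ (elements S) ++ map (inj₂ ∘ inj₁) (elements S) ++
           cartesianProductWith (λ A B → inj₂ (inj₂ (A , B))) (subsetsOf S) (subsetsOf S)

  label-∈ : ∀ x y → label x y ∈ₗ labels
  label-∈ x y with x ∈? S | y ∈? S
  ... | yes x∈S | _ = ∈-++⁺ˡ (∈-map⁺ inj₁ (∈-elements x∈S))
  ... | no _ | yes y∈S =
    ∈-++⁺ʳ (map inj₁ (elements S)) (∈-++⁺ˡ (∈-map⁺ (inj₂ ∘ inj₁) (∈-elements y∈S)))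
  ... | no _ | no _ = ∈-++⁺ʳ (map inj₁ (elements S)) (∈-++⁺ʳ (map (inj₂ ∘ inj₁) (elements S))
        (∈-cartesianProductWith⁺ _ (∈-subsetsOf (trace⊆S x)) (∈-subsetsOf (trace⊆S y))))

  length-labels : length labels ≡ ∣ S ∣ + (∣ S ∣ + 2 ^ ∣ S ∣ * 2 ^ ∣ S ∣)
  length-labels = begin
    length labels
      ≡⟨ length-++ (map inj₁ (elements S)) ⟩
    length (map inj₁ (elements S)) + length (map (inj₂ ∘ inj₁) (elements S) ++ pairs)
      ≡⟨ cong (length (map inj₁ (elements S)) +_) (length-++ (map (inj₂ ∘ inj₁) (elements S))) ⟩
    length (map inj₁ (elements S)) + (length (map (inj₂ ∘ inj₁) (elements S)) + length pairs)
      ≡⟨ cong₂ _+_ (length-map inj₁ (elements S))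
                   (cong₂ _+_ (length-map (inj₂ ∘ inj₁) (elements S))
                              (length-cartesianProductWith _ (subsetsOf S) (subsetsOf S))) ⟩
    length (elements S) + (length (elements S) + length (subsetsOf S) * length (subsetsOf S))
      ≡⟨ cong₂ _+_ (length-elements S)
                   (cong₂ _+_ (length-elements S)
                              (cong₂ _*_ (length-subsetsOf S) (length-subsetsOf S))) ⟩
    ∣ S ∣ + (∣ S ∣ + 2 ^ ∣ S ∣ * 2 ^ ∣ S ∣) ∎
    where
    open ≡-Reasoning
    pairs = cartesianProductWith (λ A B → inj₂ (inj₂ (A , B))) (subsetsOf S) (subsetsOf S)

  length-labels<bound : length labels < bound ∣ S ∣
  length-labels<bound = begin-strict
    length labels                   ≡⟨ length-labels ⟩
    k + (k + 2 ^ k * 2 ^ k)         ≡⟨ +-assoc k k _ ⟨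
    k + k + 2 ^ k * 2 ^ k           ≡⟨ cong (λ m → k + m + 2 ^ k * 2 ^ m) (+-identityʳ k) ⟨
    2 * k + 2 ^ k * 2 ^ (k + 0)     ≡⟨ cong (2 * k +_) (^-distribˡ-+-* 2 k (k + 0)) ⟨
    2 * k + 2 ^ (2 * k)             <⟨ m<m+n (2 * k + 2 ^ (2 * k)) z<s ⟩
    bound k                         ∎
    where
    open ≤-Reasoning
    k = ∣ S ∣

  data LabelCollision (x y z w : Fin n) : Set where
    same-first  : x ≡ z → LabelCollision x y z w
    same-second : y ≡ w → LabelCollision x y z w
    same-traces : x ∉ S → y ∉ S → z ∉ S → w ∉ S → SameS H S x z → SameS H S y w →
                  LabelCollision x y z w

  label-collision : ∀ x y z w → label x y ≡ label z w → LabelCollision x y z w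
  label-collision x y z w with x ∈? S | y ∈? S | z ∈? S | w ∈? S
  ... | yes _ | _     | yes _ | _     = same-first ∘ inj₁-injective
  ... | yes _ | _     | no _  | yes _ = λ ()
  ... | yes _ | _     | no _  | no _  = λ ()
  ... | no _  | yes _ | yes _ | _     = λ ()
  ... | no _  | yes _ | no _  | yes _ = same-second ∘ inj₁-injective ∘ inj₂-injective
  ... | no _  | yes _ | no _  | no _  = λ ()
  ... | no _  | no _  | yes _ | _     = λ ()
  ... | no _  | no _  | no _  | yes _ = λ ()
  ... | no x∉S | no y∉S | no z∉S | no w∉S = λ same →
    let same-x , same-y = ,-injective (inj₂-injective (inj₂-injective same))
    in same-traces x∉S y∉S z∉S w∉S (same-trace⇒SameS same-x) (same-trace⇒SameS same-y)

  record TracedPairs (C : Fin n × Fin n → Set) : Set where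
    field
      x y z w  : Fin n
      distinct : (x , y) ≢ (z , w)
      C-xy     : C (x , y)
      C-zw     : C (z , w)
      x∉S      : x ∉ S
      y∉S      : y ∉ S
      z∉S      : z ∉ S
      w∉S      : w ∉ S
      x≢z      : x ≢ z
      y≢w      : y ≢ w
      SameS-xz : SameS H S x z
      SameS-yw : SameS H S y w

  traced-pairs : (C : Fin n × Fin n → Set) →
    (∀ {u v} → C u → C v → u ≢ v → proj₁ u ≢ proj₁ v × proj₂ u ≢ proj₂ v) →
    AtLeast (bound ∣ S ∣) C → TracedPairs C
  traced-pairs C both-differ (f , f-injective , f∈C) =
    let i , j , i≢j , same-label = pigeonhole-∈ labels (uncurry label ∘ f) (uncurry label-∈ ∘ f)
                                                length-labels<bound
        fi≢fj = i≢j ∘ f-injective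
        x≢z , y≢w = both-differ (f∈C i) (f∈C j) fi≢fj
    in case label-collision _ _ _ _ same-label of λ where
      (same-first x≡z) → contradiction x≡z x≢z
      (same-second y≡w) → contradiction y≡w y≢w
      (same-traces x∉S y∉S z∉S w∉S SameS-xz SameS-yw) → record
        { x = proj₁ (f i) ; y = proj₂ (f i) ; z = proj₁ (f j) ; w = proj₂ (f j)
        ; distinct = fi≢fj ; C-xy = f∈C i ; C-zw = f∈C j
        ; x∉S = x∉S ; y∉S = y∉S ; z∉S = z∉S ; w∉S = w∉S
        ; x≢z = x≢z ; y≢w = y≢w ; SameS-xz = SameS-xz ; SameS-yw = SameS-yw }

PQAdj-functional : ∀ {p q X Y Z} → PQAdj p q X Y → PQAdj p q X Z → Y ≡ Z
PQAdj-functional {X = inj₂ (i , b)} {inj₂ (_ , c)} {inj₂ (_ , d)} (refl , b≢c) (refl , b≢d) =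
  cong (λ e → inj₂ (i , e)) (trans (¬-not (b≢c ∘ sym)) (sym (¬-not (b≢d ∘ sym))))
PQAdj-functional {X = inj₁ _} ()
PQAdj-functional {X = inj₂ _} {inj₁ _} ()
PQAdj-functional {X = inj₂ _} {inj₂ _} {inj₁ _} _ ()

module SquareRootOfMatching {n} (G H : Graph n) (root : IsSquareRoot H G) (S : Subset n)
                            {p q} (H-S≅pK₁+qK₂ : IsoPQ H S p q) where

  open IsoPQ H-S≅pK₁+qK₂
  open Traces H S using (TracedPairs; traced-pairs)

  SameS-sym : ∀ {a b} → SameS H S a b → SameS H S b a
  SameS-sym same s s∈S = ⇔-sym (same s s∈S)

  E-G⇒dist≤2 : ∀ {x y} → E G x y → E H x y ⊎ Σ (Fin n) λ u → E H x u × E H u y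
  E-G⇒dist≤2 {x} {y} xy = proj₁ (root x y (E⇒≢ G xy)) xy

  E-H⇒E-G : ∀ {x y} → E H x y → E G x y
  E-H⇒E-G {x} {y} xy = proj₂ (root x y (E⇒≢ H xy)) (inj₁ xy)

  common-neighbour⇒E-G : ∀ {x y u} → x ≢ y → E H x u → E H u y → E G x y
  common-neighbour⇒E-G {x} {y} {u} x≢y xu uy = proj₂ (root x y x≢y) (inj₂ (u , xu , uy))

  unique-partner : ∀ {u a b} → u ∉ S → a ∉ S → b ∉ S → E H u a → E H u b → a ≡ b
  unique-partner {u} {a} {b} u∉S a∉S b∉S ua ub = cong proj₁ (begin
    (a , a∉S)          ≡⟨ from-to (a , a∉S) ⟨
    from (to (a , a∉S)) ≡⟨ cong from (PQAdj-functional (proj₁ (pres (u , u∉S) (a , a∉S)) ua)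
                                                        (proj₁ (pres (u , u∉S) (b , b∉S)) ub)) ⟩
    from (to (b , b∉S)) ≡⟨ from-to (b , b∉S) ⟩
    (b , b∉S)          ∎)
    where open ≡-Reasoning

  SameS-nonadjacent⇒DisjS : ∀ {x y w} → SameS H S y w → x ≢ w → ¬ E G x w → DisjS H S x y
  SameS-nonadjacent⇒DisjS same-yw x≢w ¬xw s s∈S xs ys =
    ¬xw (common-neighbour⇒E-G x≢w xs (E-sym H (proj₁ (same-yw s s∈S) ys)))

  DisjS⇒E-H : ∀ {x y} → x ∉ S → y ∉ S → DisjS H S x y → E G x y → E H x y
  DisjS⇒E-H x∉S y∉S disjoint xy with E-G⇒dist≤2 xy
  ... | inj₁ xy = xy
  ... | inj₂ (u , xu , uy) with u ∈? S
  ...   | yes u∈S = contradiction (E-sym H uy) (disjoint u u∈S xu)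
  ...   | no u∉S = contradiction (unique-partner u∉S x∉S y∉S (E-sym H xu) uy) (E⇒≢ G xy)

  partner-MeetsS : ∀ {a b c} → a ∉ S → b ∉ S → E H a b → E G b c → c ≢ a → ¬ E G a c →
                   MeetsS H S b
  partner-MeetsS {a} {b} {c} a∉S b∉S ab bc c≢a ¬ac with E-G⇒dist≤2 bc
  ... | inj₁ bc with c ∈? S
  ...   | yes c∈S = c , c∈S , bc
  ...   | no c∉S = contradiction (unique-partner b∉S c∉S a∉S bc (E-sym H ab)) c≢a
  partner-MeetsS {a} {b} {c} a∉S b∉S ab bc c≢a ¬ac | inj₂ (u , bu , uc) with u ∈? S
  ...   | yes u∈S = u , u∈S , bu
  ...   | no u∉S = contradiction (E-H⇒E-G (subst (λ t → E H t c) u≡a uc)) ¬ac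
    where
    u≡a : u ≡ a
    u≡a = unique-partner b∉S u∉S a∉S bu (E-sym H ab)

  module _ {x y z w} (x∉S : x ∉ S) (y∉S : y ∉ S) (x≢z : x ≢ z) (y≢w : y ≢ w)
           (xy : E G x y) (zw : E G z w) where

    nested-twins⇒Type1 : SameS H S x z → NT G (x , y) (z , w) → Type1 H S x y
    nested-twins⇒Type1 same-xz nt = (x∉S , y∉S , Hxy) , avoids , meets
      where
      ¬xz : ¬ E G x z
      ¬xz = NT⇒¬E-firsts G nt x≢z
      avoids : AvoidsS H S x
      avoids s s∈S xs = SameS-nonadjacent⇒DisjS same-xz x≢z ¬xz s s∈S xs xs
      Hxy : E H x y
      Hxy = DisjS⇒E-H x∉S y∉S (λ s s∈S xs _ → avoids s s∈S xs) xy
      w≢x : w ≢ x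
      w≢x refl = ¬xz (E-sym G zw)
      meets : MeetsS H S y
      meets = partner-MeetsS x∉S y∉S Hxy (NT⇒E-seconds G nt xy y≢w) w≢x
                             (NT⇒¬E-first-second G nt y≢w)

    matched-twins⇒Type2 : SameS H S y w → MT G (x , y) (z , w) → Type2 H S x y
    matched-twins⇒Type2 same-yw mt = (x∉S , y∉S , Hxy) , meets-x , meets-y , disjoint
      where
      ¬xw : ¬ InNc G x w
      ¬xw = MT⇒¬N-first-second G mt y≢w
      ¬yz : ¬ InNc G y z
      ¬yz = MT⇒¬N-first-second G (swap mt) x≢z
      disjoint : DisjS H S x y
      disjoint = SameS-nonadjacent⇒DisjS same-yw (¬xw ∘ inj₁ ∘ sym) (¬xw ∘ inj₂)
      Hxy : E H x y
      Hxy = DisjS⇒E-H x∉S y∉S disjoint xy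
      meets-x : MeetsS H S x
      meets-x = partner-MeetsS y∉S x∉S (E-sym H Hxy) (MT⇒E-firsts G mt zw x≢z)
                               (¬yz ∘ inj₁) (¬yz ∘ inj₂)
      meets-y : MeetsS H S y
      meets-y = partner-MeetsS x∉S y∉S Hxy (MT⇒E-firsts G (swap mt) (E-sym G zw) y≢w)
                               (¬xw ∘ inj₁) (¬xw ∘ inj₂)

  module _ (C : Fin n × Fin n → Set) (C⇒E : ∀ {u} → C u → E G (proj₁ u) (proj₂ u)) where

    nested-twins-contain-Type1-pair : (∀ {u v} → C u → C v → NT G u v) →
      AtLeast (bound ∣ S ∣) C →
      Σ (Fin n × Fin n) λ { (a₁ , b₁) → Σ (Fin n × Fin n) λ { (a₂ , b₂) →
        (a₁ , b₁) ≢ (a₂ , b₂) × C (a₁ , b₁) × C (a₂ , b₂) ×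
        Type1 H S a₁ b₁ × Type1 H S a₂ b₂ × SameS H S b₁ b₂ } }
    nested-twins-contain-Type1-pair C⇒NT many = (x , y) , (z , w) , distinct , C-xy , C-zw ,
      nested-twins⇒Type1 x∉S y∉S x≢z y≢w (C⇒E C-xy) (C⇒E C-zw) SameS-xz (C⇒NT C-xy C-zw) ,
      nested-twins⇒Type1 z∉S w∉S (≢-sym x≢z) (≢-sym y≢w) (C⇒E C-zw) (C⇒E C-xy)
        (SameS-sym SameS-xz) (C⇒NT C-zw C-xy) ,
      SameS-yw
      where
      open TracedPairs (traced-pairs C
        (λ Cu Cv u≢v → NT-distinct⇒both-differ G (C⇒E Cu) u≢v (C⇒NT Cu Cv)) many)

    matched-twins-contain-Type2-pair : (∀ {u v} → C u → C v → MT G u v) →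
      AtLeast (bound ∣ S ∣) C →
      Σ (Fin n × Fin n) λ { (a₁ , b₁) → Σ (Fin n × Fin n) λ { (a₂ , b₂) →
        (a₁ , b₁) ≢ (a₂ , b₂) × C (a₁ , b₁) × C (a₂ , b₂) ×
        Type2 H S a₁ b₁ × Type2 H S a₂ b₂ × SameS H S a₁ a₂ × SameS H S b₁ b₂ } }
    matched-twins-contain-Type2-pair C⇒MT many = (x , y) , (z , w) , distinct , C-xy , C-zw ,
      matched-twins⇒Type2 x∉S y∉S x≢z y≢w (C⇒E C-xy) (C⇒E C-zw) SameS-yw (C⇒MT C-xy C-zw) ,
      matched-twins⇒Type2 z∉S w∉S (≢-sym x≢z) (≢-sym y≢w) (C⇒E C-zw) (C⇒E C-xy)
        (SameS-sym SameS-yw) (C⇒MT C-zw C-xy) ,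
      SameS-xz , SameS-yw
      where
      open TracedPairs (traced-pairs C
        (λ Cu Cv u≢v → MT-distinct⇒both-differ G (C⇒E Cu) u≢v (C⇒MT Cu Cv)) many)

mainTheorem13 : ∀ {n} (G H : Graph n) → Connected G → 3 ≤ n → IsSquareRoot H G →
    (S : Subset n) (k : ℕ) → ∣ S ∣ ≡ k → (p q : ℕ) → IsoPQ H S p q →
    ((r : Fin n × Fin n) → Comparable G r →
      AtLeast (bound k) (InClass (Comparable G) (NT G) r) →
      Σ (Fin n × Fin n) λ { (a₁ , b₁) → Σ (Fin n × Fin n) λ { (a₂ , b₂) →
        (a₁ , b₁) ≢ (a₂ , b₂) ×
        InClass (Comparable G) (NT G) r (a₁ , b₁) ×
        InClass (Comparable G) (NT G) r (a₂ , b₂) ×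
        Type1 H S a₁ b₁ × Type1 H S a₂ b₂ × SameS H S b₁ b₂ } })
    ×
    ((r : Fin n × Fin n) → AdjPair G r →
      AtLeast (bound k) (InClass (AdjPair G) (MT G) r) →
      Σ (Fin n × Fin n) λ { (a₁ , b₁) → Σ (Fin n × Fin n) λ { (a₂ , b₂) →
        (a₁ , b₁) ≢ (a₂ , b₂) ×
        InClass (AdjPair G) (MT G) r (a₁ , b₁) ×
        InClass (AdjPair G) (MT G) r (a₂ , b₂) ×
        Type2 H S a₁ b₁ × Type2 H S a₂ b₂ × SameS H S a₁ a₂ × SameS H S b₁ b₂ } })
mainTheorem13 G H _ _ root S _ refl _ _ H-S≅pK₁+qK₂ =
  (λ r _ → nested-twins-contain-Type1-pair (InClass (Comparable G) (NT G) r) (proj₁ ∘ proj₁)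
             (λ Cu Cv → NT-euclidean G (proj₂ Cu) (proj₂ Cv))) ,
  (λ r _ → matched-twins-contain-Type2-pair (InClass (AdjPair G) (MT G) r) proj₁
             (λ Cu Cv → MT-euclidean G (proj₂ Cu) (proj₂ Cv)))
  where open SquareRootOfMatching G H root S H-S≅pK₁+qK₂
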